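{- Let $s\in\mathbb{N}$ and let $\mathcal{K}_{n_1,\dots,n_r}$ be the complete $r$-partite graph with parts of sizes $n_1,\dots,n_r\in\mathbb{Z}^+$. Then ${\rm Nim}(\mathcal{C}_s(\mathcal{K}_{n_1,\dots,n_r}))={\rm Nim}(\mathcal{C}_s(\mathcal{K}_t))$, where $t:=|\{i : n_i \text{ is odd}\}|$ and $\mathcal{K}_t$ is the complete graph on $t$ vertices.
   Context: Chomp on a finite poset $P$ with global minimum $0$: two players alternately pick an element $x$ of the remaining poset and remove all elements $\ge x$; the player forced to pick $0$ loses. ${\rm Nim}(\{0\})=0$ and ${\rm Nim}(P)=\mathrm{mex}\{{\rm Nim}(P_x) : x\in P\setminus\{0\}\}$, where $P_x$ is $P$ with the up-set of $x$ removed. For a graph $G$ and $s\in\mathbb{N}$, $\mathcal{C}_s(G)$ is the simplicial complex on $V(G)$ whose faces are the cliques (sets of pairwise adjacent vertices) of size at most $s$, including the empty face; it is a poset under inclusion with minimum the empty face. -}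

module Defs where

open import Data.Bool using (Bool; true; false; not; _∧_; _∨_; if_then_else_)
open import Data.Nat using (ℕ; zero; suc; _≡ᵇ_; _≤ᵇ_; _%_)
open import Data.Nat.Properties using () renaming (_≟_ to _≟ℕ_)
open import Data.Fin using (Fin; zero; suc; splitAt; toℕ)
open import Data.Fin.Properties using () renaming (_≟_ to _≟F_)
open import Data.List using (List; []; _∷_; length; filter; map; _++_; foldr; allFin)
open import Data.Nat.ListAction using (sum)
open import Data.Vec using (Vec; []; _∷_)
open import Data.Sum using (inj₁; inj₂)
open import Relation.Nullary using (does)
open import Relation.Nullary.Decidable using (¬?)
open import Relation.Binary.PropositionalEquality using (_≡_)

_∈ℕᵇ_ : ℕ → List ℕ → Bool
k ∈ℕᵇ []       = false
k ∈ℕᵇ (x ∷ xs) = (k ≡ᵇ x) ∨ (k ∈ℕᵇ xs)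

-- search candidates k, k+1, ..., k+f ; the mex of xs is ≤ length xs
mexFrom : ℕ → ℕ → List ℕ → ℕ
mexFrom zero    k xs = k
mexFrom (suc f) k xs = if k ∈ℕᵇ xs then mexFrom f (suc k) xs else k

mex : List ℕ → ℕ
mex xs = mexFrom (length xs) 0 xs

-- A finite poset is given by the list of its (distinct) elements, a
-- (Boolean, decidable) order relation  le x y  meaning x ≤ y, and a test
-- isZero recognising its global minimum 0.
--   Nim(P) = mex { Nim(P_x) : x ∈ P, x ≠ 0 },  P_x = P minus { y : x ≤ y }.
-- Recursion uses fuel; each move removes at least x itself, so fuel
-- = number of elements is always enough (fuel never runs out).

nimFuel : {A : Set} → (A → A → Bool) → (A → Bool) → ℕ → List A → ℕ
nimFuel le isZero zero    P = 0
nimFuel le isZero (suc k) P =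
  mex (map (λ x → nimFuel le isZero k (filter (λ y → ¬? (le x y Data.Bool.≟ true)) P))
           (filter (λ x → ¬? (isZero x Data.Bool.≟ true)) P))

chompNim : {A : Set} → (A → A → Bool) → (A → Bool) → List A → ℕ
chompNim le isZero P = nimFuel le isZero (length P) P

Graph : ℕ → Set
Graph n = Fin n → Fin n → Bool

Subset : ℕ → Set
Subset n = Vec Bool n

allSubsets : (n : ℕ) → List (Subset n)
allSubsets zero    = [] ∷ []
allSubsets (suc n) = map (false ∷_) (allSubsets n) ++ map (true ∷_) (allSubsets n)

_∈ₛ_ : {n : ℕ} → Fin n → Subset n → Bool
zero  ∈ₛ (b ∷ _) = b
suc i ∈ₛ (_ ∷ v) = i ∈ₛ v

size : {n : ℕ} → Subset n → ℕ
size []          = 0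
size (true ∷ v)  = suc (size v)
size (false ∷ v) = size v

_⊆ᵇ_ : {n : ℕ} → Subset n → Subset n → Bool
[]      ⊆ᵇ []      = true
(a ∷ u) ⊆ᵇ (b ∷ v) = (not a ∨ b) ∧ (u ⊆ᵇ v)

isEmpty : {n : ℕ} → Subset n → Bool
isEmpty []      = true
isEmpty (b ∷ v) = not b ∧ isEmpty v

allᵇ : {A : Set} → (A → Bool) → List A → Bool
allᵇ p = foldr (λ x r → p x ∧ r) true

isClique : {n : ℕ} → Graph n → Subset n → Bool
isClique {n} G S =
  allᵇ (λ u → allᵇ (λ v → not (u ∈ₛ S) ∨ not (v ∈ₛ S) ∨ does (u ≟F v) ∨ G u v)
                   (allFin n))
       (allFin n)

-- The faces of C_s(G): cliques of size at most s (including the empty face)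
cliqueFaces : {n : ℕ} → ℕ → Graph n → List (Subset n)
cliqueFaces {n} s G =
  filter (λ S → (isClique G S ∧ (size S ≤ᵇ s)) Data.Bool.≟ true) (allSubsets n)

nimClique : {n : ℕ} → ℕ → Graph n → ℕ
nimClique s G = chompNim _⊆ᵇ_ isEmpty (cliqueFaces s G)

completeGraph : (t : ℕ) → Graph t
completeGraph t u v = not (does (u ≟F v))

-- Complete multipartite graph with part sizes ns = [n_1,...,n_r]:
-- vertex set Fin (n_1 + ... + n_r); the first n_1 vertices form part 0,
-- the next n_2 part 1, etc.; two vertices are adjacent iff in different parts.
partOf : (ns : List ℕ) → Fin (sum ns) → ℕ
partOf (n ∷ ns) v with splitAt n v
... | inj₁ _ = 0
... | inj₂ w = suc (partOf ns w)

completeMultipartite : (ns : List ℕ) → Graph (sum ns)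
completeMultipartite ns u v = not (does (partOf ns u ≟ℕ partOf ns v))

numOdd : List ℕ → ℕ
numOdd ns = length (filter (λ n → n % 2 ≟ℕ 1) ns)

-- Pair up the vertices inside each part, leaving the last vertex of every odd part
-- unpaired, and let σ swap partners; σ is an automorphism of K_{n_1,…,n_r}.  The
-- unpaired vertices span a copy of K_t, and a clique with at most one vertex per
-- part either consists of unpaired vertices or contains a paired vertex but not its
-- partner.  Relate a position P of the multipartite game to a position P′ of the K_t
-- game when P is σ-invariant and its faces on unpaired vertices are exactly P′.
-- Moves on unpaired vertices are copied between the games, and any other move x is
-- cancelled by the reply σ x, which returns to a related position.  By the mex
-- recursion, related positions have equal Nim-values.

module Submission where

open import Defs
open import Data.Bool using (Bool; true; false; not; _∧_; _∨_; if_then_else_; T)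
import Data.Bool as Bool
open import Data.Bool.Properties using (∨-zeroʳ; ∧-zeroʳ; not-¬)
open import Data.Empty using (⊥-elim)
open import Data.Fin using (Fin; zero; suc; splitAt)
open import Data.Fin.Properties using (0≢1+n) renaming (_≟_ to _≟F_; suc-injective to Fin-suc-injective)
open import Data.List using (List; []; _∷_; length; filter; map; allFin)
open import Data.List.Membership.Propositional using (_∈_; _∉_)
open import Data.List.Membership.Propositional.Properties
  using (∈-filter⁺; ∈-filter⁻; ∈-map⁺; ∈-map⁻; ∈-++⁺ˡ; ∈-++⁺ʳ; ∈-allFin)
open import Data.List.Properties using (filter-notAll; filter-accept; filter-reject; map-cong-local)
open import Data.List.Relation.Unary.All using (All)
import Data.List.Relation.Unary.All as All
open import Data.List.Relation.Unary.Any using (here; there)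
import Data.List.Relation.Unary.Any as Any
open import Data.Nat using (ℕ; zero; suc; _+_; _≤_; _<_; z≤n; s≤s; _≡ᵇ_; _≤ᵇ_; _%_)
open import Data.Nat.ListAction using (sum)
open import Data.Nat.Properties
  using (≡ᵇ⇒≡; ≡⇒≡ᵇ; ≤-trans; ≤-refl; ≤-reflexive; ≤-pred; <⇒≤; <-irrefl; <-cmp; +-suc; +-identityʳ;
         m≤n⇒m≤1+n; suc-injective)
  renaming (_≟_ to _≟ℕ_)
open import Data.Product using (∃; _×_; _,_; proj₁; proj₂)
open import Data.Sum using (_⊎_; inj₁; inj₂)
open import Data.Unit using (⊤; tt)
open import Data.Vec using (Vec; []; _∷_)
open import Relation.Binary.Definitions using (tri<; tri≈; tri>)
open import Relation.Nullary using (Dec; yes; no; does; contradiction)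
open import Relation.Nullary.Decidable using (¬?)
open import Relation.Binary.PropositionalEquality

∈ℕᵇ⇒∈ : ∀ k xs → k ∈ℕᵇ xs ≡ true → k ∈ xs
∈ℕᵇ⇒∈ k (x ∷ xs) h with k ≡ᵇ x in eq
... | true  = here (≡ᵇ⇒≡ k x (subst T (sym eq) _))
... | false = there (∈ℕᵇ⇒∈ k xs h)

∈⇒∈ℕᵇ : ∀ {k xs} → k ∈ xs → k ∈ℕᵇ xs ≡ true
∈⇒∈ℕᵇ {k} (here refl) with k ≡ᵇ k | ≡⇒≡ᵇ k k refl
... | true | _ = refl
∈⇒∈ℕᵇ {k} {x ∷ _} (there p) rewrite ∈⇒∈ℕᵇ p = ∨-zeroʳ (k ≡ᵇ x)

ContainsBelow : ℕ → List ℕ → Set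
ContainsBelow m xs = ∀ {j} → j < m → j ∈ xs

containsBelow-suc : ∀ {m xs} → ContainsBelow m xs → m ∈ xs → ContainsBelow (suc m) xs
containsBelow-suc {m} below m∈xs {j} (s≤s j≤m) with <-cmp j m
... | tri< j<m _ _ = below j<m
... | tri≈ _ refl _ = m∈xs
... | tri> _ _ j>m = ⊥-elim (<-irrefl refl (≤-trans j>m j≤m))

containsBelow⇒≤length : ∀ m xs → ContainsBelow m xs → m ≤ length xs
containsBelow⇒≤length zero    xs below = z≤n
containsBelow⇒≤length (suc m) xs below =
  ≤-trans (s≤s (containsBelow⇒≤length m (filter ≢m? xs) below′)) (filter-notAll ≢m? xs m∈xs)
  where
  ≢m? = λ y → ¬? (y ≟ℕ m)
  below′ : ContainsBelow m (filter ≢m? xs)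
  below′ j<m = ∈-filter⁺ ≢m? (below (m≤n⇒m≤1+n j<m)) (λ j≡m → <-irrefl j≡m j<m)
  m∈xs = Any.map (λ x≡m m≢x → m≢x (sym x≡m)) (below ≤-refl)

mexFrom-spec : ∀ f k xs → ContainsBelow k xs →
               ContainsBelow (mexFrom f k xs) xs × (mexFrom f k xs ∉ xs ⊎ mexFrom f k xs ≡ k + f)
mexFrom-spec zero    k xs below = below , inj₂ (sym (+-identityʳ k))
mexFrom-spec (suc f) k xs below with k ∈ℕᵇ xs in eq
... | false = below , inj₁ (λ k∈xs → contradiction (trans (sym eq) (∈⇒∈ℕᵇ k∈xs)) λ ())
... | true with mexFrom-spec f (suc k) xs (containsBelow-suc below (∈ℕᵇ⇒∈ k xs eq))
...   | below′ , inj₁ ∉xs      = below′ , inj₁ ∉xs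
...   | below′ , inj₂ ≡k+1+f  = below′ , inj₂ (trans ≡k+1+f (sym (+-suc k f)))

IsMex : ℕ → List ℕ → Set
IsMex r xs = r ∉ xs × ContainsBelow r xs

mex-isMex : ∀ xs → IsMex (mex xs) xs
mex-isMex xs with mexFrom-spec (length xs) 0 xs (λ ())
... | below , inj₁ ∉xs        = ∉xs , below
... | below , inj₂ ≡length = ∉xs , below
  where
  -- otherwise xs would contain the length xs + 1 numbers 0, …, length xs
  ∉xs : mex xs ∉ xs
  ∉xs ∈xs = <-irrefl refl (≤-trans (containsBelow⇒≤length _ xs (containsBelow-suc below ∈xs))
                                   (≤-reflexive (sym ≡length)))

isMex-unique : ∀ {r r′ xs} → IsMex r xs → IsMex r′ xs → r ≡ r′
isMex-unique {r} {r′} (r∉ , below) (r′∉ , below′) with <-cmp r r′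
... | tri< r<r′ _ _ = ⊥-elim (r∉ (below′ r<r′))
... | tri≈ _ r≡r′ _ = r≡r′
... | tri> _ _ r>r′ = ⊥-elim (r′∉ (below r>r′))

mex-≡ : ∀ xs ys → (∀ {v} → v ∈ ys → v ∈ xs) → (∀ {v} → v ∈ xs → v ∈ ys ⊎ v ≢ mex ys) →
        mex xs ≡ mex ys
mex-≡ xs ys ys⊆xs xs⊆ys∪ = isMex-unique (mex-isMex xs) (∉xs , λ j<m → ys⊆xs (proj₂ (mex-isMex ys) j<m))
  where
  ∉xs : mex ys ∉ xs
  ∉xs ∈xs with xs⊆ys∪ ∈xs
  ... | inj₁ ∈ys = proj₁ (mex-isMex ys) ∈ys
  ... | inj₂ ≢  = ≢ refl

module ChompGame {A : Set} (le : A → A → Bool) (isZero : A → Bool) (le-refl : ∀ x → le x x ≡ true) where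

  remove : A → List A → List A
  remove x = filter (λ y → ¬? (le x y Bool.≟ true))

  moves : List A → List A
  moves = filter (λ x → ¬? (isZero x Bool.≟ true))

  nim : List A → ℕ
  nim = chompNim le isZero

  options : List A → List ℕ
  options P = map (λ x → nim (remove x P)) (moves P)

  ∈-remove⁻ : ∀ x P {y} → y ∈ remove x P → y ∈ P × le x y ≢ true
  ∈-remove⁻ x P = ∈-filter⁻ (λ y → ¬? (le x y Bool.≟ true)) {xs = P}

  ∈-remove⁺ : ∀ x {P y} → y ∈ P → le x y ≢ true → y ∈ remove x P
  ∈-remove⁺ x = ∈-filter⁺ (λ y → ¬? (le x y Bool.≟ true))

  ∈-moves⁻ : ∀ P {x} → x ∈ moves P → x ∈ P × isZero x ≢ true
  ∈-moves⁻ P = ∈-filter⁻ (λ x → ¬? (isZero x Bool.≟ true)) {xs = P}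

  ∈-moves⁺ : ∀ {x P} → x ∈ P → isZero x ≢ true → x ∈ moves P
  ∈-moves⁺ = ∈-filter⁺ (λ x → ¬? (isZero x Bool.≟ true))

  length-remove< : ∀ {x P} → x ∈ P → length (remove x P) < length P
  length-remove< {x} {P} x∈P =
    filter-notAll (λ y → ¬? (le x y Bool.≟ true)) P (Any.map (λ { refl ¬le → ¬le (le-refl x) }) x∈P)

  length-move< : ∀ P {x} → x ∈ moves P → length (remove x P) < length P
  length-move< P x∈moves = length-remove< (proj₁ (∈-moves⁻ P x∈moves))

  nimFuel-irrelevant : ∀ k k′ P → length P ≤ k → length P ≤ k′ →
                       nimFuel le isZero k P ≡ nimFuel le isZero k′ P
  nimFuel-irrelevant zero    zero     []      _ _ = refl
  nimFuel-irrelevant zero    (suc k′) []      _ _ = refl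
  nimFuel-irrelevant (suc k) zero     []      _ _ = refl
  nimFuel-irrelevant (suc k) (suc k′) P       ≤k ≤k′ =
    cong mex (map-cong-local (All.tabulate λ x∈moves →
      let <P = length-move< P x∈moves in
      nimFuel-irrelevant k k′ _ (≤-pred (≤-trans <P ≤k)) (≤-pred (≤-trans <P ≤k′))))

  nim-unfold : ∀ P → nim P ≡ mex (options P)
  nim-unfold []      = refl
  nim-unfold (a ∷ P) =
    cong mex (map-cong-local (All.tabulate λ x∈moves →
      nimFuel-irrelevant (length P) _ _ (≤-pred (length-move< (a ∷ P) x∈moves)) ≤-refl))

  option∈options : ∀ P {x} → x ∈ moves P → nim (remove x P) ∈ options P
  option∈options P = ∈-map⁺ _

  nim-move≢nim : ∀ P {x} → x ∈ moves P → nim (remove x P) ≢ nim P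
  nim-move≢nim P x∈moves ≡nim =
    proj₁ (mex-isMex (options P)) (subst (_∈ options P) (trans ≡nim (nim-unfold P)) (option∈options P x∈moves))

module ChompSimulation {A B : Set}
    (leA : A → A → Bool) (isZeroA : A → Bool) (reflA : ∀ x → leA x x ≡ true)
    (leB : B → B → Bool) (isZeroB : B → Bool) (reflB : ∀ y → leB y y ≡ true) where

  module GA = ChompGame leA isZeroA reflA
  module GB = ChompGame leB isZeroB reflB

  record IsSimulation (R : List A → List B → Set) : Set where
    field
      copy : ∀ {P P′} → R P P′ → ∀ {y} → y ∈ GB.moves P′ →
             ∃ λ x → x ∈ GA.moves P × R (GA.remove x P) (GB.remove y P′)
      copy-or-undo : ∀ {P P′} → R P P′ → ∀ {x} → x ∈ GA.moves P →
             (∃ λ y → y ∈ GB.moves P′ × R (GA.remove x P) (GB.remove y P′)) ⊎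
             (∃ λ x′ → x′ ∈ GA.moves (GA.remove x P) × R (GA.remove x′ (GA.remove x P)) P′)

  simulation⇒nim≡ : ∀ {R} → IsSimulation R → ∀ P P′ → R P P′ → GA.nim P ≡ GB.nim P′
  simulation⇒nim≡ {R} sim P P′ = go (suc (length P)) P P′ ≤-refl
    where
    open IsSimulation sim
    go : ∀ n P P′ → length P < n → R P P′ → GA.nim P ≡ GB.nim P′
    go (suc n) P P′ (s≤s |P|≤n) r = begin
      GA.nim P             ≡⟨ GA.nim-unfold P ⟩
      mex (GA.options P)   ≡⟨ mex-≡ (GA.options P) (GB.options P′) B⊆A A⊆B∪ ⟩
      mex (GB.options P′)  ≡⟨ GB.nim-unfold P′ ⟨
      GB.nim P′            ∎
      where
      open ≡-Reasoning
      ih : ∀ {x} → x ∈ GA.moves P → ∀ {Q Q′} → length Q ≤ length (GA.remove x P) → R Q Q′ →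
           GA.nim Q ≡ GB.nim Q′
      ih x∈moves |Q|≤ = go n _ _ (≤-trans (s≤s |Q|≤) (≤-trans (GA.length-move< P x∈moves) |P|≤n))

      B⊆A : ∀ {v} → v ∈ GB.options P′ → v ∈ GA.options P
      B⊆A v∈ with ∈-map⁻ _ v∈
      ... | y , y∈moves , refl with copy r y∈moves
      ... | x , x∈moves , r′ = subst (_∈ GA.options P) (ih x∈moves ≤-refl r′) (GA.option∈options P x∈moves)

      A⊆B∪ : ∀ {v} → v ∈ GA.options P → v ∈ GB.options P′ ⊎ v ≢ mex (GB.options P′)
      A⊆B∪ v∈ with ∈-map⁻ _ v∈
      ... | x , x∈moves , refl with copy-or-undo r x∈moves
      ... | inj₁ (y , y∈moves , r′) =
        inj₁ (subst (_∈ GB.options P′) (sym (ih x∈moves ≤-refl r′)) (GB.option∈options P′ y∈moves))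
      -- the reply x′ gives remove x P an option of value nim P′
      ... | inj₂ (x′ , x′∈moves , r′) = inj₂ λ v≡mex →
        GA.nim-move≢nim (GA.remove x P) x′∈moves
          (trans (ih x∈moves (<⇒≤ (GA.length-move< (GA.remove x P) x′∈moves)) r′)
                 (trans (GB.nim-unfold P′) (sym v≡mex)))

isOdd : ℕ → Bool
isOdd zero          = false
isOdd (suc zero)    = true
isOdd (suc (suc n)) = isOdd n

oddCount : List ℕ → ℕ
oddCount []       = 0
oddCount (n ∷ ns) = if isOdd n then suc (oddCount ns) else oddCount ns

-- A Vec Bool (n + sum ns) is a set of vertices of K_{n,ns}, n being the size of the part
-- currently traversed.  Within each part the vertices are paired off as (0,1), (2,3), …;
-- the last vertex of an odd part is unpaired.
swapPairs : ∀ n ns → Vec Bool (n + sum ns) → Vec Bool (n + sum ns)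
swapPairs zero          []       []          = []
swapPairs zero          (m ∷ ns) S           = swapPairs m ns S
swapPairs (suc zero)    ns       (a ∷ S)     = a ∷ swapPairs zero ns S
swapPairs (suc (suc n)) ns       (a ∷ b ∷ S) = b ∷ a ∷ swapPairs n ns S

-- T selects odd parts; the result holds the unpaired vertex of each selected part
fromUnpaired : ∀ n ns → Vec Bool (oddCount (n ∷ ns)) → Vec Bool (n + sum ns)
fromUnpaired zero          []       []      = []
fromUnpaired zero          (m ∷ ns) T       = fromUnpaired m ns T
fromUnpaired (suc zero)    ns       (c ∷ T) = c ∷ fromUnpaired zero ns T
fromUnpaired (suc (suc n)) ns       T       = false ∷ false ∷ fromUnpaired n ns T

toUnpaired : ∀ n ns → Vec Bool (n + sum ns) → Vec Bool (oddCount (n ∷ ns))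
toUnpaired zero          []       []          = []
toUnpaired zero          (m ∷ ns) S           = toUnpaired m ns S
toUnpaired (suc zero)    ns       (a ∷ S)     = a ∷ toUnpaired zero ns S
toUnpaired (suc (suc n)) ns       (a ∷ b ∷ S) = toUnpaired n ns S

AvoidsFirst : ∀ k ns → Vec Bool (k + sum ns) → Set
AvoidsFirst zero    ns S       = ⊤
AvoidsFirst (suc k) ns (a ∷ S) = a ≡ false × AvoidsFirst k ns S

OnePerPart : ∀ n ns → Vec Bool (n + sum ns) → Set
OnePerPart zero    []       []          = ⊤
OnePerPart zero    (m ∷ ns) S           = OnePerPart m ns S
OnePerPart (suc n) ns       (false ∷ S) = OnePerPart n ns S
OnePerPart (suc n) ns       (true ∷ S)  = AvoidsFirst n ns S × OnePerPart n ns S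

onePerPart-tail : ∀ n ns a S → OnePerPart (suc n) ns (a ∷ S) → OnePerPart n ns S
onePerPart-tail n ns false S o       = o
onePerPart-tail n ns true  S (_ , o) = o

swapPairs-involutive : ∀ n ns S → swapPairs n ns (swapPairs n ns S) ≡ S
swapPairs-involutive zero          []       []          = refl
swapPairs-involutive zero          (m ∷ ns) S           = swapPairs-involutive m ns S
swapPairs-involutive (suc zero)    ns       (a ∷ S)     = cong (a ∷_) (swapPairs-involutive zero ns S)
swapPairs-involutive (suc (suc n)) ns       (a ∷ b ∷ S) = cong (λ X → a ∷ b ∷ X) (swapPairs-involutive n ns S)

∧-swap : ∀ x y z → x ∧ (y ∧ z) ≡ y ∧ (x ∧ z)
∧-swap true  y     z = refl
∧-swap false true  z = refl
∧-swap false false z = refl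

swapPairs-⊆ᵇ : ∀ n ns S S′ → (swapPairs n ns S ⊆ᵇ swapPairs n ns S′) ≡ (S ⊆ᵇ S′)
swapPairs-⊆ᵇ zero          []       []          []            = refl
swapPairs-⊆ᵇ zero          (m ∷ ns) S           S′            = swapPairs-⊆ᵇ m ns S S′
swapPairs-⊆ᵇ (suc zero)    ns       (a ∷ S)     (a′ ∷ S′)     = cong ((not a ∨ a′) ∧_) (swapPairs-⊆ᵇ zero ns S S′)
swapPairs-⊆ᵇ (suc (suc n)) ns       (a ∷ b ∷ S) (a′ ∷ b′ ∷ S′)
  rewrite swapPairs-⊆ᵇ n ns S S′ = ∧-swap (not b ∨ b′) (not a ∨ a′) (S ⊆ᵇ S′)

⊆ᵇ-swapPairs : ∀ n ns S S′ → (S ⊆ᵇ swapPairs n ns S′) ≡ (swapPairs n ns S ⊆ᵇ S′)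
⊆ᵇ-swapPairs n ns S S′ = begin
  S ⊆ᵇ swapPairs n ns S′                                   ≡⟨ swapPairs-⊆ᵇ n ns S (swapPairs n ns S′) ⟨
  swapPairs n ns S ⊆ᵇ swapPairs n ns (swapPairs n ns S′)
    ≡⟨ cong (swapPairs n ns S ⊆ᵇ_) (swapPairs-involutive n ns S′) ⟩
  swapPairs n ns S ⊆ᵇ S′                                   ∎
  where open ≡-Reasoning

swapPairs-isEmpty : ∀ n ns S → isEmpty (swapPairs n ns S) ≡ isEmpty S
swapPairs-isEmpty zero          []       []          = refl
swapPairs-isEmpty zero          (m ∷ ns) S           = swapPairs-isEmpty m ns S
swapPairs-isEmpty (suc zero)    ns       (a ∷ S)     = cong (not a ∧_) (swapPairs-isEmpty zero ns S)
swapPairs-isEmpty (suc (suc n)) ns       (a ∷ b ∷ S)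
  rewrite swapPairs-isEmpty n ns S = ∧-swap (not b) (not a) (isEmpty S)

swapPairs-size : ∀ n ns S → size (swapPairs n ns S) ≡ size S
swapPairs-size zero          []       []                  = refl
swapPairs-size zero          (m ∷ ns) S                   = swapPairs-size m ns S
swapPairs-size (suc zero)    ns       (true ∷ S)          = cong suc (swapPairs-size zero ns S)
swapPairs-size (suc zero)    ns       (false ∷ S)         = swapPairs-size zero ns S
swapPairs-size (suc (suc n)) ns       (true ∷ true ∷ S)   = cong (λ k → suc (suc k)) (swapPairs-size n ns S)
swapPairs-size (suc (suc n)) ns       (true ∷ false ∷ S)  = cong suc (swapPairs-size n ns S)
swapPairs-size (suc (suc n)) ns       (false ∷ true ∷ S)  = cong suc (swapPairs-size n ns S)
swapPairs-size (suc (suc n)) ns       (false ∷ false ∷ S) = swapPairs-size n ns S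

swapPairs-fromUnpaired : ∀ n ns T → swapPairs n ns (fromUnpaired n ns T) ≡ fromUnpaired n ns T
swapPairs-fromUnpaired zero          []       []      = refl
swapPairs-fromUnpaired zero          (m ∷ ns) T       = swapPairs-fromUnpaired m ns T
swapPairs-fromUnpaired (suc zero)    ns       (c ∷ T) = cong (c ∷_) (swapPairs-fromUnpaired zero ns T)
swapPairs-fromUnpaired (suc (suc n)) ns       T       =
  cong (λ X → false ∷ false ∷ X) (swapPairs-fromUnpaired n ns T)

fromUnpaired-⊆ᵇ : ∀ n ns T T′ → (fromUnpaired n ns T ⊆ᵇ fromUnpaired n ns T′) ≡ (T ⊆ᵇ T′)
fromUnpaired-⊆ᵇ zero          []       []      []        = refl
fromUnpaired-⊆ᵇ zero          (m ∷ ns) T       T′        = fromUnpaired-⊆ᵇ m ns T T′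
fromUnpaired-⊆ᵇ (suc zero)    ns       (c ∷ T) (c′ ∷ T′) = cong ((not c ∨ c′) ∧_) (fromUnpaired-⊆ᵇ zero ns T T′)
fromUnpaired-⊆ᵇ (suc (suc n)) ns       T       T′        = fromUnpaired-⊆ᵇ n ns T T′

fromUnpaired-isEmpty : ∀ n ns T → isEmpty (fromUnpaired n ns T) ≡ isEmpty T
fromUnpaired-isEmpty zero          []       []      = refl
fromUnpaired-isEmpty zero          (m ∷ ns) T       = fromUnpaired-isEmpty m ns T
fromUnpaired-isEmpty (suc zero)    ns       (c ∷ T) = cong (not c ∧_) (fromUnpaired-isEmpty zero ns T)
fromUnpaired-isEmpty (suc (suc n)) ns       T       = fromUnpaired-isEmpty n ns T

fromUnpaired-size : ∀ n ns T → size (fromUnpaired n ns T) ≡ size T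
fromUnpaired-size zero          []       []          = refl
fromUnpaired-size zero          (m ∷ ns) T           = fromUnpaired-size m ns T
fromUnpaired-size (suc zero)    ns       (true ∷ T)  = cong suc (fromUnpaired-size zero ns T)
fromUnpaired-size (suc zero)    ns       (false ∷ T) = fromUnpaired-size zero ns T
fromUnpaired-size (suc (suc n)) ns       T           = fromUnpaired-size n ns T

avoidsFirst-swapPairs : ∀ k ns S → AvoidsFirst k ns S → AvoidsFirst k ns (swapPairs k ns S)
avoidsFirst-swapPairs zero          ns S           _                = tt
avoidsFirst-swapPairs (suc zero)    ns (a ∷ S)     (a≡f , _)        = a≡f , tt
avoidsFirst-swapPairs (suc (suc k)) ns (a ∷ b ∷ S) (a≡f , b≡f , av) = b≡f , a≡f , avoidsFirst-swapPairs k ns S av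

onePerPart-swapPairs : ∀ n ns S → OnePerPart n ns S → OnePerPart n ns (swapPairs n ns S)
onePerPart-swapPairs zero          []       []                  _ = tt
onePerPart-swapPairs zero          (m ∷ ns) S                   o = onePerPart-swapPairs m ns S o
onePerPart-swapPairs (suc zero)    ns       (false ∷ S)         o = onePerPart-swapPairs zero ns S o
onePerPart-swapPairs (suc zero)    ns       (true ∷ S)          (_ , o) = tt , onePerPart-swapPairs zero ns S o
onePerPart-swapPairs (suc (suc n)) ns       (false ∷ false ∷ S) o = onePerPart-swapPairs n ns S o
onePerPart-swapPairs (suc (suc n)) ns       (false ∷ true ∷ S)  (av , o) =
  (refl , avoidsFirst-swapPairs n ns S av) , onePerPart-swapPairs n ns S o
onePerPart-swapPairs (suc (suc n)) ns       (true ∷ false ∷ S)  ((_ , av) , o) =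
  avoidsFirst-swapPairs n ns S av , onePerPart-swapPairs n ns S o
onePerPart-swapPairs (suc (suc n)) ns       (true ∷ true ∷ S)   ((() , _) , _)

onePerPart-fromUnpaired : ∀ n ns T → OnePerPart n ns (fromUnpaired n ns T)
onePerPart-fromUnpaired zero          []       []          = tt
onePerPart-fromUnpaired zero          (m ∷ ns) T           = onePerPart-fromUnpaired m ns T
onePerPart-fromUnpaired (suc zero)    ns       (false ∷ T) = onePerPart-fromUnpaired zero ns T
onePerPart-fromUnpaired (suc zero)    ns       (true ∷ T)  = tt , onePerPart-fromUnpaired zero ns T
onePerPart-fromUnpaired (suc (suc n)) ns       T           = onePerPart-fromUnpaired n ns T

-- S contains a paired vertex but not its partner
Asymmetric : ∀ n ns → Vec Bool (n + sum ns) → Set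
Asymmetric n ns S = (S ⊆ᵇ swapPairs n ns S) ≡ false × (∀ T → (S ⊆ᵇ fromUnpaired n ns T) ≡ false)

onePerPart⇒unpaired⊎asymmetric : ∀ n ns S → OnePerPart n ns S →
                                  S ≡ fromUnpaired n ns (toUnpaired n ns S) ⊎ Asymmetric n ns S
onePerPart⇒unpaired⊎asymmetric zero []       [] _ = inj₁ refl
onePerPart⇒unpaired⊎asymmetric zero (m ∷ ns) S o  = onePerPart⇒unpaired⊎asymmetric m ns S o
onePerPart⇒unpaired⊎asymmetric (suc zero) ns (a ∷ S) o
  with onePerPart⇒unpaired⊎asymmetric zero ns S (onePerPart-tail zero ns a S o)
... | inj₁ S≡ = inj₁ (cong (a ∷_) S≡)
... | inj₂ (⊈swap , ⊈unpaired) =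
  inj₂ ( trans (cong ((not a ∨ a) ∧_) ⊈swap) (∧-zeroʳ _)
       , λ { (c ∷ T) → trans (cong ((not a ∨ c) ∧_) (⊈unpaired T)) (∧-zeroʳ _) })
onePerPart⇒unpaired⊎asymmetric (suc (suc n)) ns (false ∷ false ∷ S) o
  with onePerPart⇒unpaired⊎asymmetric n ns S o
... | inj₁ S≡ = inj₁ (cong (λ X → false ∷ false ∷ X) S≡)
... | inj₂ asym = inj₂ asym
onePerPart⇒unpaired⊎asymmetric (suc (suc n)) ns (false ∷ true ∷ S) _ = inj₂ (refl , λ _ → refl)
onePerPart⇒unpaired⊎asymmetric (suc (suc n)) ns (true ∷ false ∷ S) _ = inj₂ (refl , λ _ → refl)
onePerPart⇒unpaired⊎asymmetric (suc (suc n)) ns (true ∷ true ∷ S) ((() , _) , _)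

allᵇ-true⁺ : ∀ {A : Set} (p : A → Bool) xs → (∀ x → p x ≡ true) → allᵇ p xs ≡ true
allᵇ-true⁺ p []       px = refl
allᵇ-true⁺ p (x ∷ xs) px rewrite px x = allᵇ-true⁺ p xs px

allᵇ-true⁻ : ∀ {A : Set} (p : A → Bool) xs → allᵇ p xs ≡ true → ∀ {x} → x ∈ xs → p x ≡ true
allᵇ-true⁻ p (y ∷ xs) all (here refl) with p y
... | true = refl
allᵇ-true⁻ p (y ∷ xs) all (there x∈) with p y
... | true = allᵇ-true⁻ p xs all x∈

cliqueCondition⁻ : ∀ {P Q : Set} a b (p? : Dec P) (q? : Dec Q) →
                   (not a ∨ not b ∨ does p? ∨ not (does q?)) ≡ true → a ≡ true → b ≡ true → Q → P
cliqueCondition⁻ true true (yes p) _       _ refl refl q = p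
cliqueCondition⁻ true true (no ¬p) (no ¬q) _ refl refl q = contradiction q ¬q

cliqueCondition⁺ : ∀ {P Q : Set} a b (p? : Dec P) (q? : Dec Q) →
                   (a ≡ true → b ≡ true → Q → P) → (not a ∨ not b ∨ does p? ∨ not (does q?)) ≡ true
cliqueCondition⁺ false b     _       _       _ = refl
cliqueCondition⁺ true  false _       _       _ = refl
cliqueCondition⁺ true  true  (yes _) _       _ = refl
cliqueCondition⁺ true  true  (no ¬p) (yes q) h = contradiction (h refl refl q) ¬p
cliqueCondition⁺ true  true  (no _)  (no _)  _ = refl

isClique-completeGraph : ∀ t T → isClique (completeGraph t) T ≡ true
isClique-completeGraph t T = allᵇ-true⁺ _ (allFin t) λ u → allᵇ-true⁺ _ (allFin t) λ v →
  cliqueCondition⁺ (u ∈ₛ T) (v ∈ₛ T) (u ≟F v) (u ≟F v) (λ _ _ u≡v → u≡v)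

PartInjective : ∀ ns → Vec Bool (sum ns) → Set
PartInjective ns S = ∀ u v → u ∈ₛ S ≡ true → v ∈ₛ S ≡ true → partOf ns u ≡ partOf ns v → u ≡ v

isClique-multipartite⁻ : ∀ ns S → isClique (completeMultipartite ns) S ≡ true → PartInjective ns S
isClique-multipartite⁻ ns S clique u v =
  cliqueCondition⁻ (u ∈ₛ S) (v ∈ₛ S) (u ≟F v) (partOf ns u ≟ℕ partOf ns v)
    (allᵇ-true⁻ _ (allFin _) (allᵇ-true⁻ _ (allFin _) clique (∈-allFin u)) (∈-allFin v))

isClique-multipartite⁺ : ∀ ns S → PartInjective ns S → isClique (completeMultipartite ns) S ≡ true
isClique-multipartite⁺ ns S inj = allᵇ-true⁺ _ (allFin _) λ u → allᵇ-true⁺ _ (allFin _) λ v →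
  cliqueCondition⁺ (u ∈ₛ S) (v ∈ₛ S) (u ≟F v) (partOf ns u ≟ℕ partOf ns v) (inj u v)

partOf-suc : ∀ k ns (i : Fin (k + sum ns)) → partOf (suc k ∷ ns) (suc i) ≡ partOf (k ∷ ns) i
partOf-suc k ns i with splitAt k i
... | inj₁ _ = refl
... | inj₂ _ = refl

avoidsFirst⇒partOf≢0 : ∀ k ns S → AvoidsFirst k ns S → ∀ i → i ∈ₛ S ≡ true → partOf (k ∷ ns) i ≢ 0
avoidsFirst⇒partOf≢0 (suc k) ns (_ ∷ S) (refl , av) zero    ()
avoidsFirst⇒partOf≢0 (suc k) ns (_ ∷ S) (refl , av) (suc i) i∈S ≡0 =
  avoidsFirst⇒partOf≢0 k ns S av i i∈S (trans (sym (partOf-suc k ns i)) ≡0)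

partOf≢0⇒avoidsFirst : ∀ k ns S → (∀ i → i ∈ₛ S ≡ true → partOf (k ∷ ns) i ≢ 0) → AvoidsFirst k ns S
partOf≢0⇒avoidsFirst zero    ns S           _   = tt
partOf≢0⇒avoidsFirst (suc k) ns (true ∷ S)  ≢0 = ⊥-elim (≢0 zero refl refl)
partOf≢0⇒avoidsFirst (suc k) ns (false ∷ S) ≢0 =
  refl , partOf≢0⇒avoidsFirst k ns S (λ i i∈S ≡0 → ≢0 (suc i) i∈S (trans (partOf-suc k ns i) ≡0))

partInjective-tail : ∀ n ns a S → PartInjective (suc n ∷ ns) (a ∷ S) → PartInjective (n ∷ ns) S
partInjective-tail n ns a S inj u v u∈S v∈S ≡part = Fin-suc-injective
  (inj (suc u) (suc v) u∈S v∈S (trans (partOf-suc n ns u) (trans ≡part (sym (partOf-suc n ns v)))))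

partInjective⇒onePerPart : ∀ n ns S → PartInjective (n ∷ ns) S → OnePerPart n ns S
partInjective⇒onePerPart zero    []       []          _   = tt
partInjective⇒onePerPart zero    (m ∷ ns) S           inj =
  partInjective⇒onePerPart m ns S (λ u v u∈S v∈S ≡part → inj u v u∈S v∈S (cong suc ≡part))
partInjective⇒onePerPart (suc n) ns       (false ∷ S) inj =
  partInjective⇒onePerPart n ns S (partInjective-tail n ns false S inj)
partInjective⇒onePerPart (suc n) ns       (true ∷ S)  inj =
  partOf≢0⇒avoidsFirst n ns S
    (λ i i∈S ≡0 → 0≢1+n (inj zero (suc i) refl i∈S (sym (trans (partOf-suc n ns i) ≡0)))) ,
  partInjective⇒onePerPart n ns S (partInjective-tail n ns true S inj)

onePerPart⇒partInjective : ∀ n ns S → OnePerPart n ns S → PartInjective (n ∷ ns) S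
onePerPart⇒partInjective zero (m ∷ ns) S o u v u∈S v∈S ≡part =
  onePerPart⇒partInjective m ns S o u v u∈S v∈S (suc-injective ≡part)
onePerPart⇒partInjective (suc n) ns (a ∷ S) o zero zero _ _ _ = refl
onePerPart⇒partInjective (suc n) ns (true ∷ S) (av , _) zero (suc v) _ v∈S ≡part =
  ⊥-elim (avoidsFirst⇒partOf≢0 n ns S av v v∈S (trans (sym (partOf-suc n ns v)) (sym ≡part)))
onePerPart⇒partInjective (suc n) ns (true ∷ S) (av , _) (suc u) zero u∈S _ ≡part =
  ⊥-elim (avoidsFirst⇒partOf≢0 n ns S av u u∈S (trans (sym (partOf-suc n ns u)) ≡part))
onePerPart⇒partInjective (suc n) ns (a ∷ S) o (suc u) (suc v) u∈S v∈S ≡part =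
  cong suc (onePerPart⇒partInjective n ns S (onePerPart-tail n ns a S o) u v u∈S v∈S
    (trans (sym (partOf-suc n ns u)) (trans ≡part (partOf-suc n ns v))))

-- K_{0,ns} and K_ns are definitionally the same graph
isClique-multipartite⇒onePerPart : ∀ ns S → isClique (completeMultipartite ns) S ≡ true → OnePerPart 0 ns S
isClique-multipartite⇒onePerPart ns S clique =
  partInjective⇒onePerPart 0 ns S (isClique-multipartite⁻ (0 ∷ ns) S clique)

onePerPart⇒isClique-multipartite : ∀ ns S → OnePerPart 0 ns S → isClique (completeMultipartite ns) S ≡ true
onePerPart⇒isClique-multipartite ns S o =
  isClique-multipartite⁺ (0 ∷ ns) S (onePerPart⇒partInjective 0 ns S o)

isOdd⇒%2≡1 : ∀ n → isOdd n ≡ true → n % 2 ≡ 1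
isOdd⇒%2≡1 (suc zero)    _   = refl
isOdd⇒%2≡1 (suc (suc n)) odd = isOdd⇒%2≡1 n odd

%2≡1⇒isOdd : ∀ n → n % 2 ≡ 1 → isOdd n ≡ true
%2≡1⇒isOdd (suc zero)    _   = refl
%2≡1⇒isOdd (suc (suc n)) odd = %2≡1⇒isOdd n odd

numOdd≡oddCount : ∀ ns → numOdd ns ≡ oddCount ns
numOdd≡oddCount []       = refl
numOdd≡oddCount (n ∷ ns) with isOdd n in odd
... | true  rewrite filter-accept (λ n → n % 2 ≟ℕ 1) {n} {ns} (isOdd⇒%2≡1 n odd) =
  cong suc (numOdd≡oddCount ns)
... | false rewrite filter-reject (λ n → n % 2 ≟ℕ 1) {n} {ns} (λ ≡1 → not-¬ odd (%2≡1⇒isOdd n ≡1)) =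
  numOdd≡oddCount ns

⊆ᵇ-refl : ∀ {n} (S : Subset n) → (S ⊆ᵇ S) ≡ true
⊆ᵇ-refl []          = refl
⊆ᵇ-refl (true ∷ S)  = ⊆ᵇ-refl S
⊆ᵇ-refl (false ∷ S) = ⊆ᵇ-refl S

∈-allSubsets : ∀ n (S : Subset n) → S ∈ allSubsets n
∈-allSubsets zero    []          = here refl
∈-allSubsets (suc n) (false ∷ S) = ∈-++⁺ˡ (∈-map⁺ (false ∷_) (∈-allSubsets n S))
∈-allSubsets (suc n) (true ∷ S)  = ∈-++⁺ʳ (map (false ∷_) (allSubsets n)) (∈-map⁺ (true ∷_) (∈-allSubsets n S))

∧-true⁻ : ∀ {a b} → (a ∧ b) ≡ true → a ≡ true × b ≡ true
∧-true⁻ {true} {true} _ = refl , refl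

module _ {n : ℕ} (s : ℕ) (G : Graph n) where

  ∈-cliqueFaces⁻ : ∀ {S} → S ∈ cliqueFaces s G → isClique G S ≡ true × (size S ≤ᵇ s) ≡ true
  ∈-cliqueFaces⁻ S∈ =
    ∧-true⁻ (proj₂ (∈-filter⁻ (λ S → (isClique G S ∧ (size S ≤ᵇ s)) Bool.≟ true) {xs = allSubsets n} S∈))

  ∈-cliqueFaces⁺ : ∀ {S} → isClique G S ≡ true → (size S ≤ᵇ s) ≡ true → S ∈ cliqueFaces s G
  ∈-cliqueFaces⁺ {S} clique small =
    ∈-filter⁺ (λ S → (isClique G S ∧ (size S ≤ᵇ s)) Bool.≟ true) (∈-allSubsets n S) (cong₂ _∧_ clique small)

module _ (ns : List ℕ) where

  private
    σ : Subset (sum ns) → Subset (sum ns)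
    σ = swapPairs 0 ns
    ι : Subset (oddCount ns) → Subset (sum ns)
    ι = fromUnpaired 0 ns

  open ChompSimulation (_⊆ᵇ_ {sum ns}) isEmpty ⊆ᵇ-refl (_⊆ᵇ_ {oddCount ns}) isEmpty ⊆ᵇ-refl

  record Mirrored (P : List (Subset (sum ns))) (P′ : List (Subset (oddCount ns))) : Set where
    field
      fromUnpaired-∈⁺ : ∀ {T} → T ∈ P′ → ι T ∈ P
      fromUnpaired-∈⁻ : ∀ {T} → ι T ∈ P → T ∈ P′
      swapPairs-∈     : ∀ {S} → S ∈ P → σ S ∈ P
      onePerPart      : ∀ {S} → S ∈ P → OnePerPart 0 ns S

  swapPairs-∈-remove : ∀ {P x S} → (∀ {S} → S ∈ P → σ S ∈ P) → S ∈ GA.remove x P → σ S ∈ GA.remove (σ x) P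
  swapPairs-∈-remove {P} {x} {S} closed S∈ =
    let S∈P , x⊈S = GA.∈-remove⁻ x P S∈ in
    GA.∈-remove⁺ (σ x) (closed S∈P) (λ σx⊆σS → x⊈S (trans (sym (swapPairs-⊆ᵇ 0 ns x S)) σx⊆σS))

  mirrored-remove-unpaired : ∀ {P P′} → Mirrored P P′ → ∀ T → Mirrored (GA.remove (ι T) P) (GB.remove T P′)
  mirrored-remove-unpaired {P} {P′} m T = record
    { fromUnpaired-∈⁺ = λ {T′} T′∈ →
        let T′∈P′ , T⊈T′ = GB.∈-remove⁻ T P′ T′∈ in
        GA.∈-remove⁺ (ι T) (fromUnpaired-∈⁺ T′∈P′) (λ ⊆ → T⊈T′ (trans (sym (fromUnpaired-⊆ᵇ 0 ns T T′)) ⊆))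
    ; fromUnpaired-∈⁻ = λ {T′} ιT′∈ →
        let ιT′∈P , ιT⊈ιT′ = GA.∈-remove⁻ (ι T) P ιT′∈ in
        GB.∈-remove⁺ T (fromUnpaired-∈⁻ ιT′∈P) (λ ⊆ → ιT⊈ιT′ (trans (fromUnpaired-⊆ᵇ 0 ns T T′) ⊆))
    ; swapPairs-∈ = λ {S} S∈ →
        subst (λ X → σ S ∈ GA.remove X P) (swapPairs-fromUnpaired 0 ns T) (swapPairs-∈-remove swapPairs-∈ S∈)
    ; onePerPart = λ S∈ → onePerPart (proj₁ (GA.∈-remove⁻ (ι T) P S∈))
    }
    where open Mirrored m

  mirrored-remove-asymmetric : ∀ {P P′} → Mirrored P P′ → ∀ {x} → Asymmetric 0 ns x →
                               Mirrored (GA.remove (σ x) (GA.remove x P)) P′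
  mirrored-remove-asymmetric {P} {P′} m {x} (x⊈σx , x⊈ι) = record
    { fromUnpaired-∈⁺ = λ {T} T∈ →
        GA.∈-remove⁺ (σ x) (GA.∈-remove⁺ x (fromUnpaired-∈⁺ T∈) (not-¬ (x⊈ι T))) (not-¬ (σx⊈ι T))
    ; fromUnpaired-∈⁻ = λ ιT∈ → fromUnpaired-∈⁻ (∈P ιT∈)
    ; swapPairs-∈ = λ {S} S∈ →
        let S∈′ , σx⊈S = GA.∈-remove⁻ (σ x) (GA.remove x P) S∈
            S∈P , x⊈S  = GA.∈-remove⁻ x P S∈′ in
        GA.∈-remove⁺ (σ x)
          (GA.∈-remove⁺ x (swapPairs-∈ S∈P) (λ ⊆ → σx⊈S (trans (sym (⊆ᵇ-swapPairs 0 ns x S)) ⊆)))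
          (λ ⊆ → x⊈S (trans (sym (swapPairs-⊆ᵇ 0 ns x S)) ⊆))
    ; onePerPart = λ S∈ → onePerPart (∈P S∈)
    }
    where
    open Mirrored m
    σx⊈ι : ∀ T → (σ x ⊆ᵇ ι T) ≡ false
    σx⊈ι T = begin
      σ x ⊆ᵇ ι T      ≡⟨ ⊆ᵇ-swapPairs 0 ns x (ι T) ⟨
      x ⊆ᵇ σ (ι T)    ≡⟨ cong (x ⊆ᵇ_) (swapPairs-fromUnpaired 0 ns T) ⟩
      x ⊆ᵇ ι T        ≡⟨ x⊈ι T ⟩
      false           ∎
      where open ≡-Reasoning
    ∈P : ∀ {S} → S ∈ GA.remove (σ x) (GA.remove x P) → S ∈ P
    ∈P S∈ = proj₁ (GA.∈-remove⁻ x P (proj₁ (GA.∈-remove⁻ (σ x) (GA.remove x P) S∈)))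

  mirrored-isSimulation : IsSimulation Mirrored
  mirrored-isSimulation = record { copy = copy ; copy-or-undo = copy-or-undo }
    where
    copy : ∀ {P P′} → Mirrored P P′ → ∀ {y} → y ∈ GB.moves P′ →
           ∃ λ x → x ∈ GA.moves P × Mirrored (GA.remove x P) (GB.remove y P′)
    copy {P′ = P′} m {y} y∈ =
      let y∈P′ , y≢∅ = GB.∈-moves⁻ P′ y∈ in
      ι y ,
      GA.∈-moves⁺ (Mirrored.fromUnpaired-∈⁺ m y∈P′) (λ ∅ → y≢∅ (trans (sym (fromUnpaired-isEmpty 0 ns y)) ∅)) ,
      mirrored-remove-unpaired m y

    copy-or-undo : ∀ {P P′} → Mirrored P P′ → ∀ {x} → x ∈ GA.moves P →
                   (∃ λ y → y ∈ GB.moves P′ × Mirrored (GA.remove x P) (GB.remove y P′)) ⊎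
                   (∃ λ x′ → x′ ∈ GA.moves (GA.remove x P) × Mirrored (GA.remove x′ (GA.remove x P)) P′)
    copy-or-undo {P} {P′} m {x} x∈ with GA.∈-moves⁻ P x∈
    ... | x∈P , x≢∅ with onePerPart⇒unpaired⊎asymmetric 0 ns x (Mirrored.onePerPart m x∈P)
    ... | inj₁ x≡ιy =
      inj₁ ( y
           , GB.∈-moves⁺ (Mirrored.fromUnpaired-∈⁻ m (subst (_∈ P) x≡ιy x∈P))
                         (λ ∅ → x≢∅ (trans (cong isEmpty x≡ιy) (trans (fromUnpaired-isEmpty 0 ns y) ∅)))
           , subst (λ X → Mirrored (GA.remove X P) (GB.remove y P′)) (sym x≡ιy) (mirrored-remove-unpaired m y))
      where y = toUnpaired 0 ns x
    ... | inj₂ asym@(x⊈σx , _) =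
      inj₂ ( σ x
           , GA.∈-moves⁺ (GA.∈-remove⁺ x (Mirrored.swapPairs-∈ m x∈P) (not-¬ x⊈σx))
                         (λ ∅ → x≢∅ (trans (sym (swapPairs-isEmpty 0 ns x)) ∅))
           , mirrored-remove-asymmetric m asym)

  mirrored-cliqueFaces : ∀ s → Mirrored (cliqueFaces s (completeMultipartite ns))
                                       (cliqueFaces s (completeGraph (oddCount ns)))
  mirrored-cliqueFaces s = record
    { fromUnpaired-∈⁺ = λ {T} T∈ →
        let _ , small = ∈-cliqueFaces⁻ s _ T∈ in
        ∈-cliqueFaces⁺ s _ (onePerPart⇒isClique-multipartite ns (ι T) (onePerPart-fromUnpaired 0 ns T))
                           (trans (cong (_≤ᵇ s) (fromUnpaired-size 0 ns T)) small)
    ; fromUnpaired-∈⁻ = λ {T} ιT∈ →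
        let _ , small = ∈-cliqueFaces⁻ s _ ιT∈ in
        ∈-cliqueFaces⁺ s _ (isClique-completeGraph _ T) (trans (cong (_≤ᵇ s) (sym (fromUnpaired-size 0 ns T))) small)
    ; swapPairs-∈ = λ {S} S∈ →
        let clique , small = ∈-cliqueFaces⁻ s _ S∈ in
        ∈-cliqueFaces⁺ s _
          (onePerPart⇒isClique-multipartite ns (σ S)
            (onePerPart-swapPairs 0 ns S (isClique-multipartite⇒onePerPart ns S clique)))
          (trans (cong (_≤ᵇ s) (swapPairs-size 0 ns S)) small)
    ; onePerPart = λ {S} S∈ → isClique-multipartite⇒onePerPart ns S (proj₁ (∈-cliqueFaces⁻ s _ S∈))
    }

  nimClique-multipartite≡complete : ∀ s →
    nimClique s (completeMultipartite ns) ≡ nimClique s (completeGraph (oddCount ns))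
  nimClique-multipartite≡complete s = simulation⇒nim≡ mirrored-isSimulation _ _ (mirrored-cliqueFaces s)

-- parts of size 0 add neither vertices nor odd parts
proposition2p13 : (s : ℕ) (ns : List ℕ) → All (λ n → 0 < n) ns →
    nimClique {sum ns} s (completeMultipartite ns)
      ≡ nimClique {numOdd ns} s (completeGraph (numOdd ns))
proposition2p13 s ns _ rewrite numOdd≡oddCount ns = nimClique-multipartite≡complete ns s
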